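{- Let $\mathsf L$ be a logic obtained by adding to the language of $\mathbf{CPL}^+$ new atoms having the empty team property (e.g. independence atoms, giving $\mathbf{PI}^+$, or inclusion atoms, giving $\mathbf{PInc}^+$). For any set $\Gamma\cup\{\phi\}$ of formulas in the language of $\mathsf L$: if $\Gamma\vdash\phi$ in the natural deduction system of $\mathsf L$, then $\Gamma\models\phi$.
   Context: $\mathbf{CPL}^+$ formulas: $\phi::=p_i\mid\neg p_i\mid\bot\mid\mathrm{NE}\mid\phi\wedge\phi\mid\phi\otimes\phi$. A valuation on $N\subseteq\mathbb N$ is $s:N\to\{0,1\}$, a team on $N$ a set of such. Semantics: $X\models p_i$ iff $s(i)=1$ for all $s\in X$; $X\models\neg p_i$ iff $s(i)=0$ for all $s\in X$; $X\models\bot$ iff $X=\emptyset$; $X\models\mathrm{NE}$ iff $X\ne\emptyset$; $\wedge$ as usual; $X\models\phi\otimes\psi$ iff $X=Y\cup Z$ with $Y\models\phi$, $Z\models\psi$. Each new atom $\alpha$ involves finitely many variables and has a team semantics depending only on the restriction of the team to the indices of these variables, with $\emptyset\models\alpha$ (e.g. $X\models p_{\vec i}\perp p_{\vec j}$ iff for all $s,s'\in X$ some $s''\in X$ has $s''(\vec i)=s(\vec i)$, $s''(\vec j)=s'(\vec j)$; $X\models p_{\vec i}\subseteq p_{\vec j}$ iff for all $s\in X$ some $s'\in X$ has $s(\vec i)=s'(\vec j)$). $\Gamma\models\phi$: every team satisfying all of $\Gamma$ satisfies $\phi$. Classical formulas: built from $p_i,\neg p_i,\bot$ by $\wedge,\otimes$.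 $p_i^1=p_i$, $p_i^0=\neg p_i$; empty $\otimes$ is $\bot$; for a team $X$ on finite $N=\{i_1,\dots,i_n\}$, $\Theta^*_X=\bigotimes_{s\in X}(p_{i_1}^{s(i_1)}\wedge\dots\wedge p_{i_n}^{s(i_n)}\wedge\mathrm{NE})$. Formulas are strings numbered from the left; $[\psi,m]$ is the occurrence of subformula $\psi$ starting at symbol $m$, $\phi(\beta/[\psi,m])$ replaces it by $\beta$. Natural deduction system of $\mathsf L$ (derivations with discharge; no substitution rule): Axiom $p_i\otimes\neg p_i$ (each $i$). Rules: standard $\wedge$-introduction/elimination; from $\phi$ infer $\phi\otimes\psi$ if $\psi$ has no $\mathrm{NE}$; from $\phi$ infer $\phi\otimes\phi$; from $\phi\otimes\psi$ and derivations of $\alpha$ from $\phi$ and from $\psi$ (discharged) infer $\alpha$, provided $\alpha$ and the other undischarged assumptions of the subderivations are classical; from $\phi\otimes\psi$ and a derivation of $\chi$ from $\psi$ (discharged) infer $\phi\otimes\chi$, provided the other undischarged assumptions of that subderivation are classical; from $\phi\otimes\psi$ infer $\psi\otimes\phi$; from $\phi\otimes(\psi\otimes\chi)$ infer $(\phi\otimes\psi)\otimes\chi$; from $p_i\wedge\neg p_i$ infer $\bot$; from $\phi\otimes\bot$ infer $\phi$; from $\bot\wedge\mathrm{NE}$ infer any $\phi$; from $\phi\otimes(\bot\wedge\mathrm{NE})$ infer $\bot\wedge\mathrm{NE}$; from $\Theta^*_X\wedge\Theta^*_Y$ infer $\bot\wedge\mathrm{NE}$ for distinct teams $X,Y$ on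 the same finite index set; from $\alpha\wedge(\psi\otimes\chi)$ infer $(\alpha\wedge\psi)\otimes(\alpha\wedge\chi)$ for classical $\alpha$; Strong elimination 1: for a finite $N$ with $Y_1,\dots,Y_k$ all nonempty teams on $N$ and an occurrence $[\mathrm{NE},m]$ in $\phi$: from $\phi$ and derivations of $\theta$ from each $\phi(\Theta^*_{Y_j}/[\mathrm{NE},m])$ (discharged) infer $\theta$; Strong elimination 2: for an occurrence $[\psi,m]$ in $\phi$: from $\phi$ and derivations of $\theta$ from $\phi(\psi\wedge\bot/[\psi,m])$ and from $\phi(\psi\wedge\mathrm{NE}/[\psi,m])$ infer $\theta$; and for each new atom $\alpha$: $\alpha$-introduction: from $\Theta^*_Y$ infer $\alpha$, where $Y$ is a team on a finite index set $N$ (containing the indices of $\alpha$) with $Y\models\alpha$; strong $\alpha$-elimination: for an occurrence $[\alpha,m]$ in $\phi$ and $Y_1,\dots,Y_k$ all teams on a finite $N$ (containing the indices of $\alpha$) satisfying $\alpha$: from $\phi$ and derivations of $\theta$ from each $\phi(\Theta^*_{Y_j}/[\alpha,m])$ (discharged) infer $\theta$. -}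

module Defs where

open import Level using (Lift; 0ℓ) renaming (suc to lsuc)
open import Data.Nat using (ℕ)
open import Data.Bool using (Bool; true; false)
open import Data.List using (List; []; _∷_; length; lookup)
open import Data.List.Membership.Propositional using (_∈_)
open import Data.List.Relation.Unary.Unique.Propositional using (Unique)
open import Data.Vec using (Vec) renaming ([] to []ᵥ; _∷_ to _∷ᵥ_; lookup to lookupᵥ)
open import Data.Fin using (Fin)
open import Data.Product using (Σ; ∃; _×_; _,_)
open import Data.Sum using (_⊎_)
open import Data.Empty using (⊥)
open import Relation.Binary.PropositionalEquality using (_≡_; _≢_)
open import Relation.Nullary using (¬_)

Val : Set
Val = ℕ → Bool

Team : Set₁
Team = Val → Set

EmptyTeam : Team
EmptyTeam _ = ⊥

Agree : List ℕ → Val → Val → Set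
Agree I s t = ∀ i → i ∈ I → s i ≡ t i

SameRestriction : List ℕ → Team → Team → Set
SameRestriction I X Y =
  (∀ s → X s → ∃ λ t → Y t × Agree I s t) ×
  (∀ t → Y t → ∃ λ s → X s × Agree I s t)

record AtomSig : Set₁ where
  field
    Atom     : Set
    vars     : Atom → List ℕ
    ⟦_⟧      : Atom → Team → Set
    locality : ∀ a X Y → SameRestriction (vars a) X Y → ⟦ a ⟧ X → ⟦ a ⟧ Y
    emptyTP  : ∀ a → ⟦ a ⟧ EmptyTeam

-- a valuation on the finite index set N (listed as i₁,…,iₙ)
FinVal : List ℕ → Set
FinVal N = Vec Bool (length N)

-- a team on N, given by a duplicate-free list of valuations on N
FinTeam : List ℕ → Set
FinTeam N = List (FinVal N)

-- the team (of total valuations) whose restriction to N is Y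
ext : (N : List ℕ) → FinTeam N → Team
ext N Y s = ∃ λ v → v ∈ Y × (∀ (k : Fin (length N)) → s (lookup N k) ≡ lookupᵥ v k)

SetEq : (N : List ℕ) → FinTeam N → FinTeam N → Set
SetEq N Y Z = (∀ v → v ∈ Y → v ∈ Z) × (∀ v → v ∈ Z → v ∈ Y)

_⊆ℕ_ : List ℕ → List ℕ → Set
I ⊆ℕ N = ∀ i → i ∈ I → i ∈ N

module Logic (S : AtomSig) where
  open AtomSig S

  infixr 6 _⋀_
  infixr 5 _⊗_

  data Form : Set where
    p    : ℕ → Form
    ¬p   : ℕ → Form
    bot  : Form
    NE   : Form
    atom : Atom → Form
    _⋀_  : Form → Form → Form
    _⊗_  : Form → Form → Form

  infix 4 _⊨_
  _⊨_ : Team → Form → Set₁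
  X ⊨ p i      = Lift (lsuc 0ℓ) (∀ s → X s → s i ≡ true)
  X ⊨ ¬p i     = Lift (lsuc 0ℓ) (∀ s → X s → s i ≡ false)
  X ⊨ bot      = Lift (lsuc 0ℓ) (∀ s → ¬ X s)
  X ⊨ NE       = Lift (lsuc 0ℓ) (∃ λ s → X s)
  X ⊨ atom a   = Lift (lsuc 0ℓ) (⟦ a ⟧ X)
  X ⊨ (φ ⋀ ψ)  = (X ⊨ φ) × (X ⊨ ψ)
  X ⊨ (φ ⊗ ψ)  = Σ Team λ Y → Σ Team λ Z →
                   ((∀ s → X s → Y s ⊎ Z s) × (∀ s → Y s ⊎ Z s → X s)) ×
                   (Y ⊨ φ) × (Z ⊨ ψ)

  Ctx : Set₁
  Ctx = Form → Set

  _,,_ : Ctx → Form → Ctx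
  (Γ ,, φ) ψ = Γ ψ ⊎ ψ ≡ φ

  _⊆_ : Ctx → Ctx → Set
  Δ ⊆ Γ = ∀ ψ → Δ ψ → Γ ψ

  infix 3 _⊫_
  _⊫_ : Ctx → Form → Set₁
  Γ ⊫ φ = ∀ (X : Team) → (∀ ψ → Γ ψ → X ⊨ ψ) → X ⊨ φ

  data Classical : Form → Set where
    c-p   : ∀ i → Classical (p i)
    c-¬p  : ∀ i → Classical (¬p i)
    c-bot : Classical bot
    c-⋀   : ∀ {φ ψ} → Classical φ → Classical ψ → Classical (φ ⋀ ψ)
    c-⊗   : ∀ {φ ψ} → Classical φ → Classical ψ → Classical (φ ⊗ ψ)

  ClassicalCtx : Ctx → Set
  ClassicalCtx Δ = ∀ ψ → Δ ψ → Classical ψ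

  data NoNE : Form → Set where
    n-p    : ∀ i → NoNE (p i)
    n-¬p   : ∀ i → NoNE (¬p i)
    n-bot  : NoNE bot
    n-atom : ∀ a → NoNE (atom a)
    n-⋀    : ∀ {φ ψ} → NoNE φ → NoNE ψ → NoNE (φ ⋀ ψ)
    n-⊗    : ∀ {φ ψ} → NoNE φ → NoNE ψ → NoNE (φ ⊗ ψ)

  -- occurrences of subformulas: a formula with one hole
  data Occ : Set where
    ∙    : Occ
    _⋀ₗ_ : Occ → Form → Occ
    _⋀ᵣ_ : Form → Occ → Occ
    _⊗ₗ_ : Occ → Form → Occ
    _⊗ᵣ_ : Form → Occ → Occ

  _[_] : Occ → Form → Form
  ∙ [ β ]        = β
  (C ⋀ₗ ψ) [ β ] = (C [ β ]) ⋀ ψ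
  (φ ⋀ᵣ C) [ β ] = φ ⋀ (C [ β ])
  (C ⊗ₗ ψ) [ β ] = (C [ β ]) ⊗ ψ
  (φ ⊗ᵣ C) [ β ] = φ ⊗ (C [ β ])

  lit : ℕ → Bool → Form
  lit i true  = p i
  lit i false = ¬p i

  conjV : (N : List ℕ) → FinVal N → Form
  conjV []      []ᵥ       = NE
  conjV (i ∷ N) (b ∷ᵥ v) = lit i b ⋀ conjV N v

  bigOtimes : List Form → Form
  bigOtimes []           = bot
  bigOtimes (φ ∷ [])     = φ
  bigOtimes (φ ∷ ψ ∷ φs) = φ ⊗ bigOtimes (ψ ∷ φs)

  mapConj : (N : List ℕ) → FinTeam N → List Form
  mapConj N []      = []
  mapConj N (v ∷ Y) = conjV N v ∷ mapConj N Y

  Θ* : (N : List ℕ) → FinTeam N → Form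
  Θ* N Y = bigOtimes (mapConj N Y)

  AllNonemptyTeams : (N : List ℕ) → List (FinTeam N) → Set
  AllNonemptyTeams N Ys =
    (∀ Y → Y ∈ Ys → Unique Y × Y ≢ []) ×
    (∀ (Z : FinTeam N) → Unique Z → Z ≢ [] → ∃ λ Y → Y ∈ Ys × SetEq N Y Z)

  AllTeamsSat : (N : List ℕ) → Atom → List (FinTeam N) → Set
  AllTeamsSat N a Ys =
    (∀ Y → Y ∈ Ys → Unique Y × ⟦ a ⟧ (ext N Y)) ×
    (∀ (Z : FinTeam N) → Unique Z → ⟦ a ⟧ (ext N Z) → ∃ λ Y → Y ∈ Ys × SetEq N Y Z)

  infix 3 _⊢_
  data _⊢_ : Ctx → Form → Set₁ where
    assume : ∀ {Γ φ} → Γ φ → Γ ⊢ φ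
    axiom  : ∀ {Γ} i → Γ ⊢ p i ⊗ ¬p i
    ⋀I     : ∀ {Γ φ ψ} → Γ ⊢ φ → Γ ⊢ ψ → Γ ⊢ φ ⋀ ψ
    ⋀E₁    : ∀ {Γ φ ψ} → Γ ⊢ φ ⋀ ψ → Γ ⊢ φ
    ⋀E₂    : ∀ {Γ φ ψ} → Γ ⊢ φ ⋀ ψ → Γ ⊢ ψ
    ⊗I     : ∀ {Γ φ ψ} → NoNE ψ → Γ ⊢ φ → Γ ⊢ φ ⊗ ψ
    ⊗dup   : ∀ {Γ φ} → Γ ⊢ φ → Γ ⊢ φ ⊗ φ
    ⊗E     : ∀ {Γ Δ₁ Δ₂ φ ψ α} →
             Classical α → Δ₁ ⊆ Γ → ClassicalCtx Δ₁ → Δ₂ ⊆ Γ → ClassicalCtx Δ₂ →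
             Γ ⊢ φ ⊗ ψ → (Δ₁ ,, φ) ⊢ α → (Δ₂ ,, ψ) ⊢ α → Γ ⊢ α
    ⊗Sub   : ∀ {Γ Δ φ ψ χ} → Δ ⊆ Γ → ClassicalCtx Δ →
             Γ ⊢ φ ⊗ ψ → (Δ ,, ψ) ⊢ χ → Γ ⊢ φ ⊗ χ
    ⊗Comm  : ∀ {Γ φ ψ} → Γ ⊢ φ ⊗ ψ → Γ ⊢ ψ ⊗ φ
    ⊗Ass   : ∀ {Γ φ ψ χ} → Γ ⊢ φ ⊗ (ψ ⊗ χ) → Γ ⊢ (φ ⊗ ψ) ⊗ χ
    ⊥I     : ∀ {Γ} i → Γ ⊢ p i ⋀ ¬p i → Γ ⊢ bot
    ⊗⊥E    : ∀ {Γ φ} → Γ ⊢ φ ⊗ bot → Γ ⊢ φ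
    ⊥NE-E  : ∀ {Γ φ} → Γ ⊢ bot ⋀ NE → Γ ⊢ φ
    ⊗⊥NE   : ∀ {Γ φ} → Γ ⊢ φ ⊗ (bot ⋀ NE) → Γ ⊢ bot ⋀ NE
    ΘDist  : ∀ {Γ} (N : List ℕ) → Unique N → (X Y : FinTeam N) →
             Unique X → Unique Y → ¬ SetEq N X Y →
             Γ ⊢ Θ* N X ⋀ Θ* N Y → Γ ⊢ bot ⋀ NE
    Distr  : ∀ {Γ α ψ χ} → Classical α →
             Γ ⊢ α ⋀ (ψ ⊗ χ) → Γ ⊢ (α ⋀ ψ) ⊗ (α ⋀ χ)
    SE₁    : ∀ {Γ θ} (N : List ℕ) → Unique N → (Ys : List (FinTeam N)) →
             AllNonemptyTeams N Ys → (C : Occ) →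
             Γ ⊢ C [ NE ] →
             (∀ Y → Y ∈ Ys → (Γ ,, (C [ Θ* N Y ])) ⊢ θ) → Γ ⊢ θ
    SE₂    : ∀ {Γ θ} (C : Occ) (ψ : Form) →
             Γ ⊢ C [ ψ ] →
             (Γ ,, (C [ ψ ⋀ bot ])) ⊢ θ → (Γ ,, (C [ ψ ⋀ NE ])) ⊢ θ → Γ ⊢ θ
    atomI  : ∀ {Γ} (a : Atom) (N : List ℕ) → Unique N → vars a ⊆ℕ N →
             (Y : FinTeam N) → Unique Y → ⟦ a ⟧ (ext N Y) →
             Γ ⊢ Θ* N Y → Γ ⊢ atom a
    atomE  : ∀ {Γ θ} (a : Atom) (N : List ℕ) → Unique N → vars a ⊆ℕ N →
             (Ys : List (FinTeam N)) → AllTeamsSat N a Ys → (C : Occ) →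
             Γ ⊢ C [ atom a ] →
             (∀ Y → Y ∈ Ys → (Γ ,, (C [ Θ* N Y ])) ⊢ θ) → Γ ⊢ θ

-- The structural rules for ⊗ with classical side
-- assumptions rest on classical formulas being closed under subteams and
-- unions, and ⊗-introduction on NE-free formulas having the empty team
-- property. A formula is satisfied through its subformula occurrences, so
-- replacing an occurrence by a formula true on the same subteam preserves
-- truth. For a finite index set N, a team satisfies Θ*_Y exactly when Y is
-- its restriction to N; with excluded middle every team has such a finite
-- restriction, which is then one of the teams enumerated by the strong
-- elimination rules, and this validates those rules.
module Submission where

open import Defs
open import Level using (0ℓ; lift)
open import Axiom.ExcludedMiddle using (ExcludedMiddle)
open import Function using (_∘_)
open import Data.Nat using (ℕ; zero; suc)
open import Data.Bool using (Bool; true; false) renaming (_≟_ to _≟ᵇ_)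
open import Data.List using (List; []; _∷_; _++_; length; lookup; map; filter; deduplicate)
open import Data.List.Membership.Propositional using (_∈_)
open import Data.List.Membership.Propositional.Properties
  using (∈-map⁺; ∈-++⁺ˡ; ∈-++⁺ʳ; ∈-++⁻; ∈-filter⁺; ∈-filter⁻; ∈-deduplicate⁺; ∈-deduplicate⁻)
open import Data.List.Relation.Unary.Any using (here; index)
open import Data.List.Relation.Unary.Any.Properties using (lookup-index)
open import Data.List.Relation.Unary.Unique.Propositional using (Unique)
open import Data.List.Relation.Unary.Unique.DecPropositional.Properties using (deduplicate-!)
open import Data.Vec using (Vec; tabulate) renaming ([] to []ᵥ; _∷_ to _∷ᵥ_; lookup to lookupᵥ)
open import Data.Vec.Properties using (≡-dec; lookup∘tabulate; tabulate∘lookup; tabulate-cong)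
open import Data.Fin using () renaming (zero to fz; suc to fs)
open import Data.Product using (∃; _×_; _,_; proj₁; proj₂)
open import Data.Sum as Sum using (_⊎_; inj₁; inj₂; [_,_]′; swap; assocˡ; assocʳ)
open import Data.Empty using (⊥-elim)
open import Relation.Binary.PropositionalEquality
  using (_≡_; _≢_; refl; sym; trans; cong; subst; module ≡-Reasoning)
open import Relation.Nullary using (¬_; yes; no)
open import Relation.Unary using (∅; Empty; Satisfiable; _∪_; _∩_; _⊆′_; _≐′_)
open import Relation.Unary.Properties using (≐′-refl; ≐′-sym; ≐′-trans)

∪-cong : {X X′ Y Y′ : Team} → X ≐′ X′ → Y ≐′ Y′ → X ∪ Y ≐′ X′ ∪ Y′
∪-cong (X⊆X′ , X′⊆X) (Y⊆Y′ , Y′⊆Y) =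
  (λ s → Sum.map (X⊆X′ s) (Y⊆Y′ s)) , (λ s → Sum.map (X′⊆X s) (Y′⊆Y s))

∪-comm : {X Y : Team} → X ∪ Y ≐′ Y ∪ X
∪-comm = (λ _ → swap) , (λ _ → swap)

∪-assoc : {X Y Z : Team} → X ∪ (Y ∪ Z) ≐′ (X ∪ Y) ∪ Z
∪-assoc = (λ _ → assocˡ) , (λ _ → assocʳ)

∪-interchange : {W X Y Z : Team} → (W ∪ X) ∪ (Y ∪ Z) ≐′ (W ∪ Y) ∪ (X ∪ Z)
∪-interchange = (λ _ → interchange) , (λ _ → interchange)
  where
  interchange : ∀ {A B C D : Set} → (A ⊎ B) ⊎ (C ⊎ D) → (A ⊎ C) ⊎ (B ⊎ D)
  interchange = [ Sum.map inj₁ inj₁ , Sum.map inj₂ inj₂ ]′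

∪-idem : {X : Team} → X ≐′ X ∪ X
∪-idem = (λ _ → inj₁) , (λ _ → [ (λ x → x) , (λ x → x) ]′)

∪-emptyʳ : {X Y : Team} → Empty Y → X ∪ Y ≐′ X
∪-emptyʳ Y-empty = (λ s → [ (λ x → x) , ⊥-elim ∘ Y-empty s ]′) , (λ _ → inj₁)

∪⇒⊆′ˡ : {X Y Z : Team} → X ≐′ Y ∪ Z → Y ⊆′ X
∪⇒⊆′ˡ (_ , Y∪Z⊆X) s = Y∪Z⊆X s ∘ inj₁

∪⇒⊆′ʳ : {X Y Z : Team} → X ≐′ Y ∪ Z → Z ⊆′ X
∪⇒⊆′ʳ (_ , Y∪Z⊆X) s = Y∪Z⊆X s ∘ inj₂

∪-restrict : {X Y Z W : Team} → W ⊆′ X → X ≐′ Y ∪ Z → W ≐′ (W ∩ Y) ∪ (W ∩ Z)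
∪-restrict W⊆X (X⊆Y∪Z , _) =
  (λ s w → Sum.map (w ,_) (w ,_) (X⊆Y∪Z s (W⊆X s w))) , (λ _ → [ proj₁ , proj₁ ]′)

∪-splitBy : (X : Team) (f : Val → Bool) →
            X ≐′ (X ∩ λ s → f s ≡ true) ∪ (X ∩ λ s → f s ≡ false)
∪-splitBy X f = (λ s x → decide s x (f s) refl) , (λ _ → [ proj₁ , proj₁ ]′)
  where
  decide : ∀ s → X s → ∀ b → f s ≡ b → (X s × f s ≡ true) ⊎ (X s × f s ≡ false)
  decide s x true  fs≡b = inj₁ (x , fs≡b)
  decide s x false fs≡b = inj₂ (x , fs≡b)

Matches : (N : List ℕ) → Val → FinVal N → Set
Matches N s v = ∀ k → s (lookup N k) ≡ lookupᵥ v k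

restrict : (N : List ℕ) → Val → FinVal N
restrict N s = tabulate (s ∘ lookup N)

matches-restrict : ∀ N s → Matches N s (restrict N s)
matches-restrict N s k = sym (lookup∘tabulate (s ∘ lookup N) k)

matches⇒≡restrict : ∀ N s v → Matches N s v → v ≡ restrict N s
matches⇒≡restrict N s v s~v = trans (sym (tabulate∘lookup v)) (tabulate-cong (sym ∘ s~v))

matches-functional : ∀ N s v w → Matches N s v → Matches N s w → v ≡ w
matches-functional N s v w s~v s~w =
  trans (matches⇒≡restrict N s v s~v) (sym (matches⇒≡restrict N s w s~w))

matches⇒agree : ∀ {I} N {s t v} → I ⊆ℕ N → Matches N s v → Matches N t v → Agree I s t
matches⇒agree N {s} {t} {v} I⊆N s~v t~v i i∈I = begin
  s i               ≡⟨ cong s i≡N[k] ⟩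
  s (lookup N k)    ≡⟨ s~v k ⟩
  lookupᵥ v k       ≡⟨ sym (t~v k) ⟩
  t (lookup N k)    ≡⟨ cong t (sym i≡N[k]) ⟩
  t i               ∎
  where
  open ≡-Reasoning
  k = index (I⊆N i i∈I)
  i≡N[k] = lookup-index (I⊆N i i∈I)

agree-sym : ∀ {I s t} → Agree I s t → Agree I t s
agree-sym s≈t i i∈I = sym (s≈t i i∈I)

sameRestriction-sym : ∀ {I X Y} → SameRestriction I X Y → SameRestriction I Y X
sameRestriction-sym (X→Y , Y→X) =
  (λ t y → let (s , x , s≈t) = Y→X t y in s , x , agree-sym s≈t) ,
  (λ s x → let (t , y , s≈t) = X→Y s x in t , y , agree-sym s≈t)

≐′⇒sameRestriction : ∀ I {X Y : Team} → X ≐′ Y → SameRestriction I X Y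
≐′⇒sameRestriction I (X⊆Y , Y⊆X) =
  (λ s x → s , X⊆Y s x , λ _ _ → refl) , (λ t y → t , Y⊆X t y , λ _ _ → refl)

booleanVectors : ∀ n → List (Vec Bool n)
booleanVectors zero    = []ᵥ ∷ []
booleanVectors (suc n) = map (true ∷ᵥ_) (booleanVectors n) ++ map (false ∷ᵥ_) (booleanVectors n)

∈-booleanVectors : ∀ {n} (v : Vec Bool n) → v ∈ booleanVectors n
∈-booleanVectors []ᵥ           = here refl
∈-booleanVectors (true ∷ᵥ v)  = ∈-++⁺ˡ (∈-map⁺ (true ∷ᵥ_) (∈-booleanVectors v))
∈-booleanVectors {suc n} (false ∷ᵥ v) =
  ∈-++⁺ʳ (map (true ∷ᵥ_) (booleanVectors n)) (∈-map⁺ (false ∷ᵥ_) (∈-booleanVectors v))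

IsRestriction : (N : List ℕ) → Team → FinTeam N → Set
IsRestriction N W Y = (∀ v → v ∈ Y → ∃ λ s → W s × Matches N s v) × (W ⊆′ ext N Y)

isRestriction-unique : ∀ N {W Y Z} → IsRestriction N W Y → IsRestriction N W Z → SetEq N Y Z
isRestriction-unique N {W} (Y⊆W , W⊆Y) (Z⊆W , W⊆Z) = included Y⊆W W⊆Z , included Z⊆W W⊆Y
  where
  included : ∀ {P Q} → (∀ v → v ∈ P → ∃ λ s → W s × Matches N s v) → W ⊆′ ext N Q →
             ∀ v → v ∈ P → v ∈ Q
  included P⊆W W⊆Q v v∈P with P⊆W v v∈P
  ... | s , w , s~v with W⊆Q s w
  ... | u , u∈Q , s~u = subst (_∈ _) (matches-functional N s u v s~u s~v) u∈Q

isRestriction-resp-setEq : ∀ N {W Y Z} → SetEq N Y Z → IsRestriction N W Z → IsRestriction N W Y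
isRestriction-resp-setEq N (Y⊆Z , Z⊆Y) (Z⊆W , W⊆Z) =
  (λ v v∈Y → Z⊆W v (Y⊆Z v v∈Y)) ,
  (λ s w → let (v , v∈Z , s~v) = W⊆Z s w in v , Z⊆Y v v∈Z , s~v)

isRestriction-nonempty : ∀ N {W Y} → IsRestriction N W Y → Satisfiable W → Y ≢ []
isRestriction-nonempty N (_ , W⊆Y) (s , w) refl with W⊆Y s w
... | _ , () , _

isRestriction⇒sameRestriction : ∀ {I} N {W Y} → I ⊆ℕ N → IsRestriction N W Y →
                                SameRestriction I W (ext N Y)
isRestriction⇒sameRestriction N I⊆N (Y⊆W , W⊆Y) =
  (λ s w → s , W⊆Y s w , λ _ _ → refl) ,
  (λ { t (v , v∈Y , t~v) → let (s , w , s~v) = Y⊆W v v∈Y in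
                           s , w , matches⇒agree N {v = v} I⊆N s~v t~v })

isRestriction-∪ : ∀ N {W A B} Y Z → W ≐′ A ∪ B →
                  IsRestriction N A Y → IsRestriction N B Z → IsRestriction N W (Y ++ Z)
isRestriction-∪ N {W} {A} {B} Y Z (W⊆A∪B , A∪B⊆W) (Y⊆A , A⊆Y) (Z⊆B , B⊆Z) =
  (λ v v∈Y++Z → [ occursʸ v , occursᶻ v ]′ (∈-++⁻ Y v∈Y++Z)) ,
  (λ s w → [ listedʸ s , listedᶻ s ]′ (W⊆A∪B s w))
  where
  occursʸ : ∀ v → v ∈ Y → ∃ λ s → W s × Matches N s v
  occursʸ v v∈Y = let (s , a , s~v) = Y⊆A v v∈Y in s , A∪B⊆W s (inj₁ a) , s~v
  occursᶻ : ∀ v → v ∈ Z → ∃ λ s → W s × Matches N s v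
  occursᶻ v v∈Z = let (s , b , s~v) = Z⊆B v v∈Z in s , A∪B⊆W s (inj₂ b) , s~v
  listedʸ : A ⊆′ ext N (Y ++ Z)
  listedʸ s a = let (v , v∈Y , s~v) = A⊆Y s a in v , ∈-++⁺ˡ v∈Y , s~v
  listedᶻ : B ⊆′ ext N (Y ++ Z)
  listedᶻ s b = let (v , v∈Z , s~v) = B⊆Z s b in v , ∈-++⁺ʳ Y v∈Z , s~v

isRestriction-++⁻ : ∀ N {W} Y Z → IsRestriction N W (Y ++ Z) →
                    W ≐′ (W ∩ ext N Y) ∪ (W ∩ ext N Z) ×
                    IsRestriction N (W ∩ ext N Y) Y × IsRestriction N (W ∩ ext N Z) Z
isRestriction-++⁻ N {W} Y Z (Y++Z⊆W , W⊆Y++Z) =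
  (split , λ s → [ proj₁ , proj₁ ]′) ,
  ((λ v v∈Y → restrictedTo (Y++Z⊆W v (∈-++⁺ˡ v∈Y)) v∈Y) , λ _ → proj₂) ,
  ((λ v v∈Z → restrictedTo (Y++Z⊆W v (∈-++⁺ʳ Y v∈Z)) v∈Z) , λ _ → proj₂)
  where
  split : W ⊆′ (W ∩ ext N Y) ∪ (W ∩ ext N Z)
  split s w = let (v , v∈Y++Z , s~v) = W⊆Y++Z s w in
    Sum.map (λ v∈Y → w , v , v∈Y , s~v) (λ v∈Z → w , v , v∈Z , s~v) (∈-++⁻ Y v∈Y++Z)
  restrictedTo : ∀ {P v} → (∃ λ s → W s × Matches N s v) → v ∈ P →
                 ∃ λ s → (W ∩ ext N P) s × Matches N s v
  restrictedTo (s , w , s~v) v∈P = s , (w , _ , v∈P , s~v) , s~v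

module _ (lem : ExcludedMiddle 0ℓ) (N : List ℕ) (W : Team) where

  private
    Occurs : FinVal N → Set
    Occurs v = ∃ λ s → W s × Matches N s v

    occurring : List (FinVal N)
    occurring = filter (λ v → lem {Occurs v}) (booleanVectors (length N))

  restriction : FinTeam N
  restriction = deduplicate (≡-dec _≟ᵇ_) occurring

  restriction-unique : Unique restriction
  restriction-unique = deduplicate-! (≡-dec _≟ᵇ_) occurring

  restriction-isRestriction : IsRestriction N W restriction
  restriction-isRestriction =
    (λ v v∈R → proj₂ (∈-filter⁻ (λ v → lem {Occurs v}) {xs = booleanVectors (length N)}
                        (∈-deduplicate⁻ (≡-dec _≟ᵇ_) occurring v∈R))) ,
    (λ s w → restrict N s ,
      ∈-deduplicate⁺ (≡-dec _≟ᵇ_)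
        (∈-filter⁺ (λ v → lem {Occurs v}) (∈-booleanVectors _) (s , w , matches-restrict N s)) ,
      matches-restrict N s)

module Semantics (S : AtomSig) where
  open AtomSig S
  open Logic S

  ⊨-resp-≐′ : ∀ φ {X Y} → X ≐′ Y → X ⊨ φ → Y ⊨ φ
  ⊨-resp-≐′ (p i)    (_ , Y⊆X) (lift X⊨) = lift λ s y → X⊨ s (Y⊆X s y)
  ⊨-resp-≐′ (¬p i)   (_ , Y⊆X) (lift X⊨) = lift λ s y → X⊨ s (Y⊆X s y)
  ⊨-resp-≐′ bot      (_ , Y⊆X) (lift X⊨) = lift λ s y → X⊨ s (Y⊆X s y)
  ⊨-resp-≐′ NE       (X⊆Y , _) (lift (s , x)) = lift (s , X⊆Y s x)
  ⊨-resp-≐′ (atom a) {X} {Y} X≐Y (lift X⊨) =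
    lift (locality a X Y (≐′⇒sameRestriction (vars a) X≐Y) X⊨)
  ⊨-resp-≐′ (φ ⋀ ψ)  X≐Y (X⊨φ , X⊨ψ) = ⊨-resp-≐′ φ X≐Y X⊨φ , ⊨-resp-≐′ ψ X≐Y X⊨ψ
  ⊨-resp-≐′ (φ ⊗ ψ)  X≐Y (A , B , X≐A∪B , A⊨φ , B⊨ψ) =
    A , B , ≐′-trans (≐′-sym X≐Y) X≐A∪B , A⊨φ , B⊨ψ

  classical-downwardClosed : ∀ {φ} → Classical φ → ∀ {X Y} → Y ⊆′ X → X ⊨ φ → Y ⊨ φ
  classical-downwardClosed (c-p i)   Y⊆X (lift X⊨) = lift λ s y → X⊨ s (Y⊆X s y)
  classical-downwardClosed (c-¬p i)  Y⊆X (lift X⊨) = lift λ s y → X⊨ s (Y⊆X s y)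
  classical-downwardClosed c-bot     Y⊆X (lift X⊨) = lift λ s y → X⊨ s (Y⊆X s y)
  classical-downwardClosed (c-⋀ c d) Y⊆X (X⊨φ , X⊨ψ) =
    classical-downwardClosed c Y⊆X X⊨φ , classical-downwardClosed d Y⊆X X⊨ψ
  classical-downwardClosed (c-⊗ c d) {Y = Y} Y⊆X (A , B , X≐A∪B , A⊨φ , B⊨ψ) =
    Y ∩ A , Y ∩ B , ∪-restrict Y⊆X X≐A∪B ,
    classical-downwardClosed c (λ _ → proj₂) A⊨φ ,
    classical-downwardClosed d (λ _ → proj₂) B⊨ψ

  classical-unionClosed : ∀ {φ} → Classical φ → ∀ {X Y Z} → X ≐′ Y ∪ Z → Y ⊨ φ → Z ⊨ φ → X ⊨ φ
  classical-unionClosed (c-p i)  (X⊆Y∪Z , _) (lift Y⊨) (lift Z⊨) =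
    lift λ s x → [ Y⊨ s , Z⊨ s ]′ (X⊆Y∪Z s x)
  classical-unionClosed (c-¬p i) (X⊆Y∪Z , _) (lift Y⊨) (lift Z⊨) =
    lift λ s x → [ Y⊨ s , Z⊨ s ]′ (X⊆Y∪Z s x)
  classical-unionClosed c-bot    (X⊆Y∪Z , _) (lift Y⊨) (lift Z⊨) =
    lift λ s x → [ Y⊨ s , Z⊨ s ]′ (X⊆Y∪Z s x)
  classical-unionClosed (c-⋀ c d) X≐Y∪Z (Y⊨φ , Y⊨ψ) (Z⊨φ , Z⊨ψ) =
    classical-unionClosed c X≐Y∪Z Y⊨φ Z⊨φ , classical-unionClosed d X≐Y∪Z Y⊨ψ Z⊨ψ
  classical-unionClosed (c-⊗ c d) X≐Y∪Z
    (A₁ , B₁ , Y≐A₁∪B₁ , A₁⊨φ , B₁⊨ψ) (A₂ , B₂ , Z≐A₂∪B₂ , A₂⊨φ , B₂⊨ψ) =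
    A₁ ∪ A₂ , B₁ ∪ B₂ ,
    ≐′-trans X≐Y∪Z (≐′-trans (∪-cong Y≐A₁∪B₁ Z≐A₂∪B₂) ∪-interchange) ,
    classical-unionClosed c ≐′-refl A₁⊨φ A₂⊨φ ,
    classical-unionClosed d ≐′-refl B₁⊨ψ B₂⊨ψ

  noNE-emptyTeam : ∀ {φ} → NoNE φ → ∀ {X} → Empty X → X ⊨ φ
  noNE-emptyTeam (n-p i)    X-empty = lift λ s → ⊥-elim ∘ X-empty s
  noNE-emptyTeam (n-¬p i)   X-empty = lift λ s → ⊥-elim ∘ X-empty s
  noNE-emptyTeam n-bot      X-empty = lift X-empty
  noNE-emptyTeam (n-atom a) {X} X-empty =
    lift (locality a EmptyTeam X
      (≐′⇒sameRestriction (vars a) ((λ _ ()) , λ s → ⊥-elim ∘ X-empty s)) (emptyTP a))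
  noNE-emptyTeam (n-⋀ c d)  X-empty = noNE-emptyTeam c X-empty , noNE-emptyTeam d X-empty
  noNE-emptyTeam (n-⊗ c d)  {X} X-empty =
    X , X , ∪-idem , noNE-emptyTeam c X-empty , noNE-emptyTeam d X-empty

  ⊨-occurrence : ∀ C {β X} → X ⊨ C [ β ] →
                 ∃ λ W → W ⊨ β × (∀ β′ → W ⊨ β′ → X ⊨ C [ β′ ])
  ⊨-occurrence ∙ X⊨β = _ , X⊨β , λ _ X⊨β′ → X⊨β′
  ⊨-occurrence (C ⋀ₗ ψ) (l , r) with ⊨-occurrence C l
  ... | W , W⊨β , plug = W , W⊨β , λ β′ W⊨β′ → plug β′ W⊨β′ , r
  ⊨-occurrence (φ ⋀ᵣ C) (l , r) with ⊨-occurrence C r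
  ... | W , W⊨β , plug = W , W⊨β , λ β′ W⊨β′ → l , plug β′ W⊨β′
  ⊨-occurrence (C ⊗ₗ ψ) (A , B , X≐A∪B , l , r) with ⊨-occurrence C l
  ... | W , W⊨β , plug = W , W⊨β , λ β′ W⊨β′ → A , B , X≐A∪B , plug β′ W⊨β′ , r
  ⊨-occurrence (φ ⊗ᵣ C) (A , B , X≐A∪B , l , r) with ⊨-occurrence C r
  ... | W , W⊨β , plug = W , W⊨β , λ β′ W⊨β′ → A , B , X≐A∪B , l , plug β′ W⊨β′

  ⊨-lit⁻ : ∀ {W} i b → W ⊨ lit i b → ∀ s → W s → s i ≡ b
  ⊨-lit⁻ i true  (lift W⊨) = W⊨
  ⊨-lit⁻ i false (lift W⊨) = W⊨

  ⊨-lit⁺ : ∀ {W} i b → (∀ s → W s → s i ≡ b) → W ⊨ lit i b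
  ⊨-lit⁺ i true  W⊨ = lift W⊨
  ⊨-lit⁺ i false W⊨ = lift W⊨

  ⊨-conjV⁻ : ∀ {W} N v → W ⊨ conjV N v → Satisfiable W × (∀ s → W s → Matches N s v)
  ⊨-conjV⁻ []      []ᵥ       (lift W≢∅) = W≢∅ , λ _ _ ()
  ⊨-conjV⁻ (i ∷ N) (b ∷ᵥ v) (W⊨b , W⊨v) with ⊨-conjV⁻ N v W⊨v
  ... | W≢∅ , W~v = W≢∅ , λ where
    s w fz      → ⊨-lit⁻ i b W⊨b s w
    s w (fs k)  → W~v s w k

  ⊨-conjV⁺ : ∀ {W} N v → Satisfiable W → (∀ s → W s → Matches N s v) → W ⊨ conjV N v
  ⊨-conjV⁺ []      []ᵥ       W≢∅ _   = lift W≢∅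
  ⊨-conjV⁺ (i ∷ N) (b ∷ᵥ v) W≢∅ W~v =
    ⊨-lit⁺ i b (λ s w → W~v s w fz) ,
    ⊨-conjV⁺ N v W≢∅ (λ s w k → W~v s w (fs k))

  ⊨-Θ*⁻ : ∀ N Y {W} → W ⊨ Θ* N Y → IsRestriction N W Y
  ⊨-Θ*⁻ N []          (lift W-empty) = (λ _ ()) , λ s → ⊥-elim ∘ W-empty s
  ⊨-Θ*⁻ N (v ∷ [])    W⊨v with ⊨-conjV⁻ N v W⊨v
  ... | (s , w) , W~v = (λ { _ (here refl) → s , w , W~v s w }) , λ s w → v , here refl , W~v s w
  ⊨-Θ*⁻ N (v ∷ u ∷ Y) (A , B , W≐A∪B , A⊨v , B⊨Y) =
    isRestriction-∪ N (v ∷ []) (u ∷ Y) W≐A∪B (⊨-Θ*⁻ N (v ∷ []) A⊨v) (⊨-Θ*⁻ N (u ∷ Y) B⊨Y)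

  ⊨-Θ*⁺ : ∀ N Y {W} → IsRestriction N W Y → W ⊨ Θ* N Y
  ⊨-Θ*⁺ N []          (_ , W⊆Y) = lift λ s w → ext-[]-empty s (W⊆Y s w)
    where ext-[]-empty : Empty (ext N [])
          ext-[]-empty _ (_ , () , _)
  ⊨-Θ*⁺ N (v ∷ [])    {W} (Y⊆W , W⊆Y) =
    ⊨-conjV⁺ N v (let (s , w , _) = Y⊆W v (here refl) in s , w) W~v
    where
    W~v : ∀ s → W s → Matches N s v
    W~v s w with W⊆Y s w
    ... | _ , here refl , s~v = s~v
  ⊨-Θ*⁺ N (v ∷ u ∷ Y) R =
    let (W≐A∪B , A↾v , B↾Y) = isRestriction-++⁻ N (v ∷ []) (u ∷ Y) R
    in _ , _ , W≐A∪B , ⊨-Θ*⁺ N (v ∷ []) A↾v , ⊨-Θ*⁺ N (u ∷ Y) B↾Y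

  Θ*⇒atom : ∀ {W N Y} a → vars a ⊆ℕ N → ⟦ a ⟧ (ext N Y) → W ⊨ Θ* N Y → W ⊨ atom a
  Θ*⇒atom {W} {N} {Y} a vars⊆N Y⊨a W⊨Y =
    lift (locality a (ext N Y) W
      (sameRestriction-sym (isRestriction⇒sameRestriction N vars⊆N (⊨-Θ*⁻ N Y W⊨Y))) Y⊨a)

  _⊨ᶜ_ : Team → Ctx → Set₁
  X ⊨ᶜ Γ = ∀ ψ → Γ ψ → X ⊨ ψ

  ⊨ᶜ-,, : ∀ {X Γ φ} → X ⊨ᶜ Γ → X ⊨ φ → X ⊨ᶜ (Γ ,, φ)
  ⊨ᶜ-,, X⊨Γ X⊨φ ψ (inj₁ ψ∈Γ) = X⊨Γ ψ ψ∈Γ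
  ⊨ᶜ-,, X⊨Γ X⊨φ ψ (inj₂ refl) = X⊨φ

  classicalCtx-downwardClosed : ∀ {Γ Δ X Y} → Δ ⊆ Γ → ClassicalCtx Δ → Y ⊆′ X → X ⊨ᶜ Γ → Y ⊨ᶜ Δ
  classicalCtx-downwardClosed Δ⊆Γ Δ-classical Y⊆X X⊨Γ ψ ψ∈Δ =
    classical-downwardClosed (Δ-classical ψ ψ∈Δ) Y⊆X (X⊨Γ ψ (Δ⊆Γ ψ ψ∈Δ))

  ⊭bot⋀NE : ∀ {X} → ¬ (X ⊨ bot ⋀ NE)
  ⊭bot⋀NE (lift X-empty , lift (s , x)) = X-empty s x

module Soundness (S : AtomSig) (lem : ExcludedMiddle 0ℓ) where
  open AtomSig S
  open Logic S
  open Semantics S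

  listed⇒⊨Θ* : ∀ {N W} {Ys : List (FinTeam N)} →
               (∃ λ Y → Y ∈ Ys × SetEq N Y (restriction lem N W)) →
               ∃ λ Y → Y ∈ Ys × W ⊨ Θ* N Y
  listed⇒⊨Θ* {N} {W} (Y , Y∈Ys , Y≃R) =
    Y , Y∈Ys , ⊨-Θ*⁺ N Y (isRestriction-resp-setEq N Y≃R (restriction-isRestriction lem N W))

  NE⇒listed-Θ* : ∀ N {Ys W} → AllNonemptyTeams N Ys → W ⊨ NE → ∃ λ Y → Y ∈ Ys × W ⊨ Θ* N Y
  NE⇒listed-Θ* N {W = W} (_ , listed) (lift W≢∅) =
    listed⇒⊨Θ* (listed _ (restriction-unique lem N W)
      (isRestriction-nonempty N (restriction-isRestriction lem N W) W≢∅))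

  atom⇒listed-Θ* : ∀ N {Ys W} a → vars a ⊆ℕ N → AllTeamsSat N a Ys → W ⊨ atom a →
                   ∃ λ Y → Y ∈ Ys × W ⊨ Θ* N Y
  atom⇒listed-Θ* N {W = W} a vars⊆N (_ , listed) (lift W⊨a) =
    listed⇒⊨Θ* (listed _ (restriction-unique lem N W)
      (locality a W _
        (isRestriction⇒sameRestriction N vars⊆N (restriction-isRestriction lem N W)) W⊨a))

  ⊨-empty⊎nonempty : ∀ {W} ψ → W ⊨ ψ → W ⊨ ψ ⋀ bot ⊎ W ⊨ ψ ⋀ NE
  ⊨-empty⊎nonempty {W} ψ W⊨ψ with lem {Satisfiable W}
  ... | yes W≢∅ = inj₂ (W⊨ψ , lift W≢∅)
  ... | no  W≡∅ = inj₁ (W⊨ψ , lift λ s w → W≡∅ (s , w))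

  sound : ∀ {Γ φ} → Γ ⊢ φ → Γ ⊫ φ
  sound (assume φ∈Γ) X X⊨Γ = X⊨Γ _ φ∈Γ
  sound (axiom i) X X⊨Γ = _ , _ , ∪-splitBy X (λ s → s i) , lift (λ _ → proj₂) , lift (λ _ → proj₂)
  sound (⋀I d d′) X X⊨Γ = sound d X X⊨Γ , sound d′ X X⊨Γ
  sound (⋀E₁ d) X X⊨Γ = proj₁ (sound d X X⊨Γ)
  sound (⋀E₂ d) X X⊨Γ = proj₂ (sound d X X⊨Γ)
  sound (⊗I ψ-noNE d) X X⊨Γ =
    X , ∅ , ≐′-sym (∪-emptyʳ λ _ ()) , sound d X X⊨Γ , noNE-emptyTeam ψ-noNE λ _ ()
  sound (⊗dup d) X X⊨Γ = X , X , ∪-idem , sound d X X⊨Γ , sound d X X⊨Γ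
  sound (⊗E α-classical Δ₁⊆Γ Δ₁-classical Δ₂⊆Γ Δ₂-classical d d₁ d₂) X X⊨Γ
    with sound d X X⊨Γ
  ... | A , B , X≐A∪B , A⊨φ , B⊨ψ =
    classical-unionClosed α-classical X≐A∪B
      (sound d₁ A (⊨ᶜ-,, (classicalCtx-downwardClosed Δ₁⊆Γ Δ₁-classical (∪⇒⊆′ˡ X≐A∪B) X⊨Γ) A⊨φ))
      (sound d₂ B (⊨ᶜ-,, (classicalCtx-downwardClosed Δ₂⊆Γ Δ₂-classical (∪⇒⊆′ʳ X≐A∪B) X⊨Γ) B⊨ψ))
  sound (⊗Sub Δ⊆Γ Δ-classical d d₁) X X⊨Γ with sound d X X⊨Γ
  ... | A , B , X≐A∪B , A⊨φ , B⊨ψ =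
    A , B , X≐A∪B , A⊨φ ,
    sound d₁ B (⊨ᶜ-,, (classicalCtx-downwardClosed Δ⊆Γ Δ-classical (∪⇒⊆′ʳ X≐A∪B) X⊨Γ) B⊨ψ)
  sound (⊗Comm d) X X⊨Γ with sound d X X⊨Γ
  ... | A , B , X≐A∪B , A⊨φ , B⊨ψ = B , A , ≐′-trans X≐A∪B ∪-comm , B⊨ψ , A⊨φ
  sound (⊗Ass d) X X⊨Γ with sound d X X⊨Γ
  ... | A , _ , X≐A∪BC , A⊨φ , (B , C , BC≐B∪C , B⊨ψ , C⊨χ) =
    A ∪ B , C , ≐′-trans X≐A∪BC (≐′-trans (∪-cong ≐′-refl BC≐B∪C) ∪-assoc) ,
    (A , B , ≐′-refl , A⊨φ , B⊨ψ) , C⊨χ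
  sound (⊥I i d) X X⊨Γ with sound d X X⊨Γ
  ... | lift X⊨p , lift X⊨¬p = lift λ s x → true≢false (trans (sym (X⊨p s x)) (X⊨¬p s x))
    where true≢false : true ≢ false
          true≢false ()
  sound (⊗⊥E {φ = φ} d) X X⊨Γ with sound d X X⊨Γ
  ... | A , B , X≐A∪B , A⊨φ , lift B-empty =
    ⊨-resp-≐′ φ (≐′-sym (≐′-trans X≐A∪B (∪-emptyʳ B-empty))) A⊨φ
  sound (⊥NE-E d) X X⊨Γ = ⊥-elim (⊭bot⋀NE (sound d X X⊨Γ))
  sound (⊗⊥NE d) X X⊨Γ with sound d X X⊨Γ
  ... | _ , _ , _ , _ , B⊨⊥NE = ⊥-elim (⊭bot⋀NE B⊨⊥NE)
  sound (ΘDist N _ Y Z _ _ Y≄Z d) X X⊨Γ with sound d X X⊨Γ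
  ... | X⊨Y , X⊨Z = ⊥-elim (Y≄Z (isRestriction-unique N (⊨-Θ*⁻ N Y X⊨Y) (⊨-Θ*⁻ N Z X⊨Z)))
  sound (Distr α-classical d) X X⊨Γ with sound d X X⊨Γ
  ... | X⊨α , (A , B , X≐A∪B , A⊨ψ , B⊨χ) =
    A , B , X≐A∪B ,
    (classical-downwardClosed α-classical (∪⇒⊆′ˡ X≐A∪B) X⊨α , A⊨ψ) ,
    (classical-downwardClosed α-classical (∪⇒⊆′ʳ X≐A∪B) X⊨α , B⊨χ)
  sound (SE₁ N _ Ys all C d ds) X X⊨Γ with ⊨-occurrence C (sound d X X⊨Γ)
  ... | W , W⊨NE , plug with NE⇒listed-Θ* N all W⊨NE
  ... | Y , Y∈Ys , W⊨Y = sound (ds Y Y∈Ys) X (⊨ᶜ-,, X⊨Γ (plug _ W⊨Y))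
  sound (SE₂ C ψ d d₁ d₂) X X⊨Γ with ⊨-occurrence C (sound d X X⊨Γ)
  ... | W , W⊨ψ , plug with ⊨-empty⊎nonempty ψ W⊨ψ
  ... | inj₁ W⊨ψ⋀⊥  = sound d₁ X (⊨ᶜ-,, X⊨Γ (plug _ W⊨ψ⋀⊥))
  ... | inj₂ W⊨ψ⋀NE = sound d₂ X (⊨ᶜ-,, X⊨Γ (plug _ W⊨ψ⋀NE))
  sound (atomI a N _ vars⊆N Y _ Y⊨a d) X X⊨Γ = Θ*⇒atom a vars⊆N Y⊨a (sound d X X⊨Γ)
  sound (atomE a N _ vars⊆N Ys all C d ds) X X⊨Γ with ⊨-occurrence C (sound d X X⊨Γ)
  ... | W , W⊨a , plug with atom⇒listed-Θ* N a vars⊆N all W⊨a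
  ... | Y , Y∈Ys , W⊨Y = sound (ds Y Y∈Ys) X (⊨ᶜ-,, X⊨Γ (plug _ W⊨Y))

theorem5p18 : (S : AtomSig) → ExcludedMiddle 0ℓ →
    (Γ : Logic.Ctx S) (φ : Logic.Form S) →
    Logic._⊢_ S Γ φ → Logic._⊫_ S Γ φ
theorem5p18 S lem Γ φ = Soundness.sound S lem
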